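{- Let $G$ be a connected graph, $k$ a positive integer, and $f$ an extremal $k$-color connection coloring of $G$. For each color $r$ used by $f$, let $F_r$ be the subgraph induced by the set of edges colored $r$. Then each $F_r$ is a forest, and $$cc_k(G)=m(G)-W_k(G),\qquad\text{where } W_k(G)=\sum_{r}\big(m(F_r)-1\big),$$ the sum taken over all colors $r$ used by $f$.
   Context: All graphs are finite, simple and undirected; $m(H)$ denotes the number of edges of $H$. For an edge-coloring $f$ of a connected graph $G$ and vertices $u,v$, the color-distance $cd_f(u,v)$ is the minimum number of distinct colors appearing on a $u$–$v$ path (and $0$ if $u=v$). The color-diameter $cD_f(G)$ is $\max\{cd_f(u,v):u,v\in V(G)\}$. An edge-coloring $f$ is a $k$-color connection coloring if $cD_f(G)\le k$. The $k$-color connection number $cc_k(G)$ is the maximum number of colors used by a $k$-color connection coloring of $G$, and a $k$-color connection coloring using $cc_k(G)$ colors is called extremal. -}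

module Defs where

open import Data.Nat using (ℕ; zero; suc; _+_; _∸_; _≤_)
open import Data.Fin using (Fin)
open import Data.Fin.Properties using () renaming (_≟_ to _≟ᶠ_)
open import Data.List using (List; []; _∷_; length; map; filter; deduplicate; allFin)
open import Data.Nat.ListAction using (sum)
open import Data.List.Relation.Unary.All using (All)
open import Data.List.Relation.Unary.Unique.Propositional using (Unique)
open import Data.Product using (Σ; _×_; _,_; ∃; ∃-syntax)
open import Data.Sum using (_⊎_)
open import Relation.Binary.PropositionalEquality using (_≡_; _≢_)
open import Relation.Nullary using (¬_)

record Graph : Set where
  field
    n    : ℕ
    m    : ℕ
    ends : Fin m → Fin n × Fin n
  Joins : Fin m → Fin n → Fin n → Set
  Joins e u w = (ends e ≡ (u , w)) ⊎ (ends e ≡ (w , u))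
  field
    noLoops  : ∀ e u → ¬ Joins e u u
    noMulti  : ∀ e e' u w → Joins e u w → Joins e' u w → e ≡ e'

open Graph public

edgeCount : Graph → ℕ
edgeCount G = m G

module _ (G : Graph) where

  data Walk : Fin (n G) → Fin (n G) → Set where
    []   : ∀ {u} → Walk u u
    step : ∀ {u w v} (e : Fin (m G)) → Joins G e u w → Walk w v → Walk u v

  walkVertices : ∀ {u v} → Walk u v → List (Fin (n G))
  walkVertices {u} [] = u ∷ []
  walkVertices {u} (step e _ p) = u ∷ walkVertices p

  walkEdges : ∀ {u v} → Walk u v → List (Fin (m G))
  walkEdges [] = []
  walkEdges (step e _ p) = e ∷ walkEdges p

  IsPath : ∀ {u v} → Walk u v → Set
  IsPath p = Unique (walkVertices p)

  Connected : Set
  Connected = ∀ u v → Σ (Walk u v) IsPath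

  -- an edge-coloring using exactly c colors (colors Fin c, all used)
  Surjective : ∀ {c} → (Fin (m G) → Fin c) → Set
  Surjective {c} f = ∀ (r : Fin c) → ∃[ e ] f e ≡ r

  numColors : ∀ {c} {u v} → (Fin (m G) → Fin c) → Walk u v → ℕ
  numColors f p = length (deduplicate _≟ᶠ_ (map f (walkEdges p)))

  CdAtMost : ∀ {c} → (Fin (m G) → Fin c) → ℕ → Fin (n G) → Fin (n G) → Set
  CdAtMost f k u v = Σ (Walk u v) λ p → IsPath p × (numColors f p ≤ k)

  IsKCC : ∀ {c} → (Fin (m G) → Fin c) → ℕ → Set
  IsKCC f k = ∀ u v → CdAtMost f k u v

  IsCCNumber : ℕ → ℕ → Set
  IsCCNumber k c =
    (Σ (Fin (m G) → Fin c) λ f → Surjective f × IsKCC f k) ×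
    (∀ c' (f' : Fin (m G) → Fin c') → Surjective f' → IsKCC f' k → c' ≤ c)

  IsExtremal : ∀ {c} → (Fin (m G) → Fin c) → ℕ → Set
  IsExtremal {c} f k = Surjective f × IsKCC f k × IsCCNumber k c

  -- a cycle in the subgraph F_r of edges colored r:
  -- an edge e joining u and w, followed by a path from w back to u of length ≥ 2
  -- (so the cycle has ≥ 3 edges and distinct vertices), all edges colored r
  HasCycleOfColor : ∀ {c} → (Fin (m G) → Fin c) → Fin c → Set
  HasCycleOfColor f r =
    Σ (Fin (n G)) λ u → Σ (Fin (n G)) λ w → Σ (Fin (m G)) λ e →
    Σ (Walk w u) λ p →
      Joins G e u w × IsPath p × (2 ≤ length (walkEdges p)) ×
      (f e ≡ r) × All (λ e' → f e' ≡ r) (walkEdges p)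

  IsForestOfColor : ∀ {c} → (Fin (m G) → Fin c) → Fin c → Set
  IsForestOfColor f r = ¬ HasCycleOfColor f r

  edgesOfColor : ∀ {c} → (Fin (m G) → Fin c) → Fin c → ℕ
  edgesOfColor f r = length (filter (λ e → f e ≟ᶠ r) (allFin (m G)))

  W : ∀ {c} → (Fin (m G) → Fin c) → ℕ
  W {c} f = sum (map (λ r → edgesOfColor f r ∸ 1) (allFin c))

module Submission where

-- Suppose F_r contains a cycle: an edge e joining u and w
-- together with a path D from w to u of color r that does not use e.  Give
-- e a brand-new color and keep all other colors.  This new coloring still
-- uses every color (D contains an edge of color r besides e), and it is
-- still a k-color connection coloring: in any path realising cd_f(x,y) ≤ k
-- we reroute every passage through e along D, which only introduces the
-- color r that the path already carried, and then shorten the resulting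
-- walk to a path.  So there is a k-color connection coloring with c + 1
-- colors, contradicting the maximality of c.
--
-- Counting part.  The color classes partition the edge set and each is
-- nonempty (all colors are used), so m(G) = Σ_r m(F_r) = c + Σ_r (m(F_r) − 1).

open import Defs
open import Algebra.Properties.CommutativeSemigroup using (x∙yz≈y∙xz)
open import Data.Nat using (ℕ; zero; suc; _+_; _∸_; _≤_; z≤n; s≤s)
open import Data.Nat.Properties
  using (+-suc; m+n∸n≡m; m+[n∸m]≡n; n≮n; ≤-trans; ≤-reflexive; +-commutativeSemigroup)
open import Data.Fin using (Fin; zero; suc)
open import Data.Fin.Properties using (_≟_; suc-injective)
open import Data.Product using (Σ; ∃; _×_; _,_; map₂)
open import Data.Sum using (_⊎_; inj₁; inj₂)
open import Data.List using (List; []; _∷_; _++_; [_]; length; map; filter; reverse; tabulate; deduplicate; allFin)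
open import Data.List.Properties
  using (length-map; length-tabulate; map-tabulate; tabulate-cong; unfold-reverse; filter-notAll; filter-some)
open import Data.Nat.ListAction using (sum)
open import Data.List.Membership.Propositional using (_∈_; _∉_)
open import Data.List.Membership.Propositional.Properties
  using (∈-map⁺; ∈-map⁻; ∈-filter⁺; ∈-allFin; ∈-deduplicate⁺; ∈-deduplicate⁻)
open import Data.List.Relation.Binary.Subset.Propositional using (_⊆_)
open import Data.List.Relation.Binary.Subset.Propositional.Properties using (All-resp-⊇)
open import Data.List.Relation.Unary.Any using (here; there)
import Data.List.Relation.Unary.Any as Any
open import Data.List.Relation.Unary.Any.Properties using (reverse⁻)
open import Data.List.Relation.Unary.All using (All; []; _∷_)
import Data.List.Relation.Unary.All as All
open import Data.List.Relation.Unary.All.Properties using (++⁺; ¬Any⇒All¬)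
open import Data.List.Relation.Unary.AllPairs using ([]; _∷_)
open import Data.List.Relation.Unary.Unique.Propositional using (Unique)
open import Data.List.Relation.Unary.Unique.DecPropositional.Properties using (deduplicate-!)
open import Function using (_∘_)
open import Relation.Binary.Definitions using (DecidableEquality)
open import Relation.Binary.PropositionalEquality
  using (_≡_; _≢_; refl; sym; trans; cong; cong₂; subst; module ≡-Reasoning)
open import Relation.Nullary using (¬_; yes; no; ¬?)
open import Relation.Unary using (Decidable)

open ≡-Reasoning

module _ {A : Set} (_≟ᴬ_ : DecidableEquality A) where

  -- A duplicate-free list whose entries all occur in ys is no longer than ys:
  -- the tail lies in ys with x filtered out, which is strictly shorter as x ∈ ys.
  unique-⊆-length : ∀ {xs ys : List A} → Unique xs → xs ⊆ ys → length xs ≤ length ys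
  unique-⊆-length {[]} _ _ = z≤n
  unique-⊆-length {x ∷ xs} {ys} (x∉xs ∷ xs-unique) x∷xs⊆ys =
    ≤-trans (s≤s (unique-⊆-length xs-unique xs⊆ys-x)) (filter-notAll ≢x? ys x∈ys)
    where
    ≢x? : Decidable (_≢ x)
    ≢x? y = ¬? (y ≟ᴬ x)

    xs⊆ys-x : xs ⊆ filter ≢x? ys
    xs⊆ys-x z∈xs = ∈-filter⁺ ≢x? (x∷xs⊆ys (there z∈xs)) (λ z≡x → All.lookup x∉xs z∈xs (sym z≡x))

    x∈ys : Any.Any (λ y → ¬ (y ≢ x)) ys
    x∈ys = Any.map (λ x≡y y≢x → y≢x (sym x≡y)) (x∷xs⊆ys (here refl))

module _ {A B : Set} (_≟ᴬ_ : DecidableEquality A) (_≟ᴮ_ : DecidableEquality B) (h : A → B) where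

  distinct-≤ : ∀ (xs : List B) (ys : List A) → xs ⊆ map h ys →
    length (deduplicate _≟ᴮ_ xs) ≤ length (deduplicate _≟ᴬ_ ys)
  distinct-≤ xs ys xs⊆h[ys] =
    ≤-trans (unique-⊆-length _≟ᴮ_ (deduplicate-! _≟ᴮ_ xs) dedup⊆)
            (≤-reflexive (length-map h (deduplicate _≟ᴬ_ ys)))
    where
    dedup⊆ : deduplicate _≟ᴮ_ xs ⊆ map h (deduplicate _≟ᴬ_ ys)
    dedup⊆ x∈ with ∈-map⁻ h (xs⊆h[ys] (∈-deduplicate⁻ _≟ᴮ_ xs x∈))
    ... | y , y∈ys , refl = ∈-map⁺ h (∈-deduplicate⁺ _≟ᴬ_ y∈ys)

∑ : ∀ {c} → (Fin c → ℕ) → ℕ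
∑ a = sum (tabulate a)

∑-cong : ∀ {c} {a b : Fin c → ℕ} → (∀ r → a r ≡ b r) → ∑ a ≡ ∑ b
∑-cong a≗b = cong sum (tabulate-cong a≗b)

∑-zero : ∀ {c} → ∑ {c} (λ _ → 0) ≡ 0
∑-zero {zero} = refl
∑-zero {suc c} = ∑-zero {c}

∑-bump : ∀ {c} {a b : Fin c → ℕ} (i : Fin c) →
  a i ≡ suc (b i) → (∀ r → r ≢ i → a r ≡ b r) → ∑ a ≡ suc (∑ b)
∑-bump {suc c} zero aᵢ elsewhere =
  cong₂ _+_ aᵢ (∑-cong (λ r → elsewhere (suc r) (λ ())))
∑-bump {suc c} {a} {b} (suc i) aᵢ elsewhere = begin
  a zero + ∑ (a ∘ suc)        ≡⟨ cong₂ _+_ (elsewhere zero (λ ())) (∑-bump i aᵢ elsewhere′) ⟩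
  b zero + suc (∑ (b ∘ suc))  ≡⟨ +-suc (b zero) _ ⟩
  suc (∑ b)                   ∎
  where
  elsewhere′ : ∀ r → r ≢ i → a (suc r) ≡ b (suc r)
  elsewhere′ r r≢i = elsewhere (suc r) (r≢i ∘ suc-injective)

∑-minus-one : ∀ {c} (a : Fin c → ℕ) → (∀ r → 1 ≤ a r) → ∑ a ≡ c + ∑ (λ r → a r ∸ 1)
∑-minus-one {zero} a _ = refl
∑-minus-one {suc c} a positive = begin
  a zero + ∑ (a ∘ suc)              ≡⟨ cong (a zero +_) (∑-minus-one (a ∘ suc) (positive ∘ suc)) ⟩
  a zero + (c + S)                  ≡⟨ x∙yz≈y∙xz +-commutativeSemigroup (a zero) c S ⟩
  c + (a zero + S)                  ≡⟨ cong (λ t → c + (t + S)) (sym (m+[n∸m]≡n (positive zero))) ⟩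
  c + (suc (a zero ∸ 1) + S)        ≡⟨ +-suc c _ ⟩
  suc c + (a zero ∸ 1 + S)          ∎
  where
  S = ∑ (λ r → a (suc r) ∸ 1)

module Walks (G : Graph) where

  private
    V = Fin (n G)
    E = Fin (m G)

  open import Data.List.Membership.DecPropositional (_≟_ {n G}) using (_∈?_)

  joins-sym : ∀ {g a b} → Joins G g a b → Joins G g b a
  joins-sym (inj₁ p) = inj₂ p
  joins-sym (inj₂ p) = inj₁ p

  joins-unique : ∀ {g a b s t} → Joins G g a b → Joins G g s t →
    (a ≡ s × b ≡ t) ⊎ (a ≡ t × b ≡ s)
  joins-unique (inj₁ refl) (inj₁ refl) = inj₁ (refl , refl)
  joins-unique (inj₁ refl) (inj₂ refl) = inj₂ (refl , refl)
  joins-unique (inj₂ refl) (inj₁ refl) = inj₂ (refl , refl)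
  joins-unique (inj₂ refl) (inj₂ refl) = inj₁ (refl , refl)

  _++ʷ_ : ∀ {a b d} → Walk G a b → Walk G b d → Walk G a d
  [] ++ʷ q = q
  step e J p ++ʷ q = step e J (p ++ʷ q)

  edges-++ʷ : ∀ {a b d} (p : Walk G a b) (q : Walk G b d) →
    walkEdges G (p ++ʷ q) ≡ walkEdges G p ++ walkEdges G q
  edges-++ʷ [] q = refl
  edges-++ʷ (step e J p) q = cong (e ∷_) (edges-++ʷ p q)

  reverseʷ : ∀ {a b} → Walk G a b → Walk G b a
  reverseʷ [] = []
  reverseʷ (step e J p) = reverseʷ p ++ʷ step e (joins-sym J) []

  edges-reverseʷ : ∀ {a b} (p : Walk G a b) → walkEdges G (reverseʷ p) ≡ reverse (walkEdges G p)
  edges-reverseʷ [] = refl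
  edges-reverseʷ (step e J p) = begin
    walkEdges G (reverseʷ p ++ʷ step e (joins-sym J) [])  ≡⟨ edges-++ʷ (reverseʷ p) _ ⟩
    walkEdges G (reverseʷ p) ++ [ e ]                      ≡⟨ cong (_++ [ e ]) (edges-reverseʷ p) ⟩
    reverse (walkEdges G p) ++ [ e ]                       ≡⟨ sym (unfold-reverse e (walkEdges G p)) ⟩
    reverse (e ∷ walkEdges G p)                            ∎

  PathWithin : V → V → List E → Set
  PathWithin a v es = Σ (Walk G a v) λ q → IsPath G q × walkEdges G q ⊆ es

  suffixFrom : ∀ {a u v} (p : Walk G a v) → IsPath G p → u ∈ walkVertices G p →
    PathWithin u v (walkEdges G p)
  suffixFrom [] p-path (here refl) = [] , p-path , λ g∈ → g∈
  suffixFrom (step e J p) p-path (here refl) = step e J p , p-path , λ g∈ → g∈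
  suffixFrom (step e J p) (_ ∷ p-path) (there u∈p) with suffixFrom p p-path u∈p
  ... | q , q-path , q⊆p = q , q-path , there ∘ q⊆p

  -- Prepending an edge a–w to a w–v path within es gives an a–v path within
  -- e ∷ es: if a already lies on the path, cut the path at a instead.
  prepend : ∀ {a w v es} (e : E) → Joins G e a w → PathWithin w v es → PathWithin a v (e ∷ es)
  prepend {a} e J (q , q-path , q⊆es) with a ∈? walkVertices G q
  ... | yes a∈q =
    let (q′ , q′-path , q′⊆q) = suffixFrom q q-path a∈q in q′ , q′-path , there ∘ q⊆es ∘ q′⊆q
  ... | no a∉q =
    step e J q , ¬Any⇒All¬ _ a∉q ∷ q-path , λ { (here refl) → here refl ; (there g∈) → there (q⊆es g∈) }

  shortcut : ∀ {a v} (p : Walk G a v) → PathWithin a v (walkEdges G p)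
  shortcut [] = [] , [] ∷ [] , λ g∈ → g∈
  shortcut (step e J p) = prepend e J (shortcut p)

  start-∈ : ∀ {a v} (p : Walk G a v) → a ∈ walkVertices G p
  start-∈ [] = here refl
  start-∈ (step _ _ _) = here refl

  end-∈ : ∀ {a v} (p : Walk G a v) → v ∈ walkVertices G p
  end-∈ [] = here refl
  end-∈ (step _ _ p) = there (end-∈ p)

  endpoint-∈ : ∀ {a v g x y} (p : Walk G a v) → g ∈ walkEdges G p → Joins G g x y →
    x ∈ walkVertices G p
  endpoint-∈ (step e J p) (here refl) K with joins-unique K J
  ... | inj₁ (refl , _) = here refl
  ... | inj₂ (refl , _) = there (start-∈ p)
  endpoint-∈ (step e J p) (there g∈p) K = there (endpoint-∈ p g∈p K)

  -- A chord joining the two ends of a path with at least two edges is not an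
  -- edge of that path: it would either be a loop or force an end vertex to
  -- occur twice on the path.
  chord-∉ : ∀ {w u e} (p : Walk G w u) → IsPath G p → 2 ≤ length (walkEdges G p) →
    Joins G e u w → e ∉ walkEdges G p
  chord-∉ (step _ _ []) _ (s≤s ()) _ _
  chord-∉ {u = u} {e = e} (step .e J (step g K p)) (_ ∷ w₁∉p ∷ _) _ e-joins (here refl)
    with joins-unique e-joins J
  ... | inj₁ (refl , _) = noLoops G e u e-joins
  ... | inj₂ (refl , _) = All.lookup w₁∉p (end-∈ p) refl
  chord-∉ (step g J p) (w∉p ∷ _) _ e-joins (there e∈p) =
    All.lookup w∉p (endpoint-∈ p e∈p (joins-sym e-joins)) refl

module FreshColor (G : Graph) {c : ℕ} (f : Fin (m G) → Fin c) (e : Fin (m G)) where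

  open Walks G

  fresh : Fin (m G) → Fin (suc c)
  fresh g with g ≟ e
  ... | yes _ = zero
  ... | no _ = suc (f g)

  fresh-e : fresh e ≡ zero
  fresh-e with e ≟ e
  ... | yes _ = refl
  ... | no e≢e with () ← e≢e refl

  fresh-≢ : ∀ {g} → g ≢ e → fresh g ≡ suc (f g)
  fresh-≢ {g} g≢e with g ≟ e
  ... | yes g≡e with () ← g≢e g≡e
  ... | no _ = refl

  SameColorAsE : Fin (m G) → Set
  SameColorAsE g = g ≢ e × f g ≡ f e

  fresh-surjective : Surjective G f → ∃ SameColorAsE → Surjective G fresh
  fresh-surjective surj _ zero = e , fresh-e
  fresh-surjective surj (g′ , g′≢e , fg′≡fe) (suc r) with surj r
  ... | g , fg≡r with g ≟ e
  ...   | no g≢e = g , trans (fresh-≢ g≢e) (cong suc fg≡r)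
  ...   | yes refl = g′ , trans (fresh-≢ g′≢e) (cong suc (trans fg′≡fe fg≡r))

  module _ {u w} (e-joins : Joins G e u w) (D : Walk G w u)
           (D-ok : All SameColorAsE (walkEdges G D)) where

    detour : ∀ {a b} → Joins G e a b →
      Σ (Walk G a b) λ D′ → All SameColorAsE (walkEdges G D′)
    detour J with joins-unique J e-joins
    ... | inj₁ (refl , refl) =
      reverseʷ D , subst (All SameColorAsE) (sym (edges-reverseʷ D)) (All-resp-⊇ reverse⁻ D-ok)
    ... | inj₂ (refl , refl) = D , D-ok

    Rerouted : ∀ {x y} → Walk G x y → Fin (m G) → Set
    Rerouted P g = g ≢ e × f g ∈ map f (walkEdges G P)

    -- Replacing each passage through e by a detour yields a walk avoiding e
    -- that introduces no new colors (the detour has the color of e).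
    reroute : ∀ {x y} (P : Walk G x y) → Σ (Walk G x y) λ Q → All (Rerouted P) (walkEdges G Q)
    reroute [] = [] , []
    reroute (step g J P) with reroute P
    ... | Q , Q-ok with g ≟ e
    ...   | no g≢e = step g J Q , (g≢e , here refl) ∷ All.map (map₂ there) Q-ok
    ...   | yes refl with detour J
    ...     | D′ , D′-ok =
      D′ ++ʷ Q , subst (All (Rerouted (step g J P))) (sym (edges-++ʷ D′ Q))
                       (++⁺ (All.map (map₂ here) D′-ok) (All.map (map₂ there) Q-ok))

    -- A rerouted walk, shortened to a path, sees no more fresh colors than P sees colors.
    fresh-kcc : ∀ {k} → IsKCC G f k → IsKCC G fresh k
    fresh-kcc kcc x y with kcc x y
    ... | P , _ , P≤k with reroute P
    ...   | Q , Q-ok with shortcut Q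
    ...     | Q′ , Q′-path , Q′⊆Q =
      Q′ , Q′-path , ≤-trans (distinct-≤ _≟_ _≟_ suc _ _ colors⊆) P≤k
      where
      Q′-ok : All (Rerouted P) (walkEdges G Q′)
      Q′-ok = All-resp-⊇ Q′⊆Q Q-ok

      colors⊆ : map fresh (walkEdges G Q′) ⊆ map suc (map f (walkEdges G P))
      colors⊆ z∈ with ∈-map⁻ fresh z∈
      ... | g , g∈Q′ , refl with All.lookup Q′-ok g∈Q′
      ...   | g≢e , fg∈P = subst (_∈ _) (sym (fresh-≢ g≢e)) (∈-map⁺ suc fg∈P)

-- A monochromatic cycle (chord e plus path D) would let e take a fresh color,
-- giving a k-color connection coloring with c + 1 colors.
extremal⇒forest : ∀ (G : Graph) {c k} (f : Fin (m G) → Fin c) → IsExtremal G f k →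
  ∀ r → IsForestOfColor G f r
extremal⇒forest G {c} f (surj , kcc , _ , maximal) _
                (_ , _ , e , D , e-joins , D-path , D-long , fe≡r , D-colored) =
  n≮n c (maximal (suc c) fresh (fresh-surjective surj (other-edge D-long D-ok))
                                (fresh-kcc e-joins D D-ok kcc))
  where
  open Walks G
  open FreshColor G f e

  D-ok : All SameColorAsE (walkEdges G D)
  D-ok = All.tabulate λ g∈D →
    (λ { refl → chord-∉ D D-path D-long e-joins g∈D }) , trans (All.lookup D-colored g∈D) (sym fe≡r)

  other-edge : ∀ {es} → 2 ≤ length es → All SameColorAsE es → ∃ SameColorAsE
  other-edge _ (g-ok ∷ _) = _ , g-ok

module _ {X : Set} {c : ℕ} (f : X → Fin c) where

  classSize : List X → Fin c → ℕ
  classSize L r = length (filter (λ x → f x ≟ r) L)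

  classSize-same : ∀ x L → classSize (x ∷ L) (f x) ≡ suc (classSize L (f x))
  classSize-same x L with f x ≟ f x
  ... | yes _ = refl
  ... | no fx≢fx with () ← fx≢fx refl

  classSize-other : ∀ x L r → r ≢ f x → classSize (x ∷ L) r ≡ classSize L r
  classSize-other x L r r≢fx with f x ≟ r
  ... | yes fx≡r with () ← r≢fx (sym fx≡r)
  ... | no _ = refl

  ∑-classSize : ∀ L → ∑ (classSize L) ≡ length L
  ∑-classSize [] = ∑-zero {c}
  ∑-classSize (x ∷ L) =
    trans (∑-bump (f x) (classSize-same x L) (classSize-other x L)) (cong suc (∑-classSize L))

surjective⇒colorCount : ∀ (G : Graph) {c} (f : Fin (m G) → Fin c) → Surjective G f →
  c ≡ edgeCount G ∸ W G f
surjective⇒colorCount G {c} f surj = begin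
  c                            ≡⟨ sym (m+n∸n≡m c (W G f)) ⟩
  c + W G f ∸ W G f            ≡⟨ cong (_∸ W G f) (sym edgeCount≡) ⟩
  edgeCount G ∸ W G f          ∎
  where
  classNonempty : ∀ r → 1 ≤ edgesOfColor G f r
  classNonempty r with surj r
  ... | g , fg≡r = filter-some (λ g → f g ≟ r) (Any.map (λ { refl → fg≡r }) (∈-allFin g))

  W-as-∑ : W G f ≡ ∑ (λ r → edgesOfColor G f r ∸ 1)
  W-as-∑ = cong sum (map-tabulate (λ r → r) (λ r → edgesOfColor G f r ∸ 1))

  edgeCount≡ : edgeCount G ≡ c + W G f
  edgeCount≡ = begin
    m G                                     ≡⟨ sym (length-tabulate (λ g → g)) ⟩
    length (allFin (m G))                   ≡⟨ sym (∑-classSize f (allFin (m G))) ⟩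
    ∑ (edgesOfColor G f)                    ≡⟨ ∑-minus-one (edgesOfColor G f) classNonempty ⟩
    c + ∑ (λ r → edgesOfColor G f r ∸ 1)    ≡⟨ cong (c +_) (sym W-as-∑) ⟩
    c + W G f                               ∎

lemma4p2 : (G : Graph) → Connected G → (k : ℕ) → 1 ≤ k →
    (c : ℕ) → (f : Fin (m G) → Fin c) → IsExtremal G f k →
      ((r : Fin c) → IsForestOfColor G f r) × (c ≡ edgeCount G ∸ W G f)
lemma4p2 G _ k _ c f extremal@(surj , _) =
  extremal⇒forest G f extremal , surjective⇒colorCount G f surj
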